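{- Let $S$ be a nonempty subset of $\mathbb{Z}$ and let $\mathcal{T}\subseteq\mathbb{N}$. Then for every positive integer $n<|S|$, the generalized integer $[n]_{S,\mathcal{T}}:=\dfrac{n!_{S,\mathcal{T}}}{(n-1)!_{S,\mathcal{T}}}$ is a positive integer.
   Context: For integers $b\ge0$ and $a\in\mathbb{Z}$ let $\operatorname{ord}_b(a):=\sup\{k\in\mathbb{N}: a\mathbb{Z}\subseteq b^k\mathbb{Z}\}$ (convention $0^0=1$); for $b\ge2$ this is the largest $k$ with $b^k\mid a$, $\operatorname{ord}_b(0)=+\infty$; $\operatorname{ord}_1\equiv+\infty$; $\operatorname{ord}_0(a)=0$ for $a\ne0$, $\operatorname{ord}_0(0)=+\infty$. For nonempty $S\subseteq\mathbb{Z}$, a $b$-ordering of $S$ is an infinite sequence $(a_i)_{i\ge0}$ in $S$ such that for every $i\ge1$, $\sum_{j<i}\operatorname{ord}_b(a_i-a_j)=\min_{a'\in S}\sum_{j<i}\operatorname{ord}_b(a'-a_j)$. The quantity $\alpha_k(S,b):=\sum_{j<k}\operatorname{ord}_b(a_k-a_j)$ (with $\alpha_0=0$) does not depend on the choice of $b$-ordering. For $\mathcal{T}\subseteq\mathbb{N}$, $k!_{S,\mathcal{T}}:=\prod_{b\in\mathcal{T}}b^{\alpha_k(S,b)}$, with conventions $b^{+\infty}=0$ for $b\ge2$ and $b=0$, $1^{+\infty}=1$, and $b^0=1$ for all $b$. -}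

module Defs where

open import Data.Nat as ℕ using (ℕ; zero; suc; _^_; _*_; _≤_; _/_)
open import Data.Nat.Divisibility using (_∣?_)
open import Data.Integer as ℤ using (ℤ; ∣_∣; _-_)
open import Data.Bool using (Bool; true; false; if_then_else_)
open import Data.Fin using (Fin)
open import Data.Product using (Σ; ∃; _×_)
open import Function.Definitions using (Injective)
open import Relation.Nullary using (yes; no)
open import Relation.Binary.PropositionalEquality using (_≡_)

data ℕ∞ : Set where
  fin : ℕ → ℕ∞
  ∞   : ℕ∞

infixl 6 _+∞_
_+∞_ : ℕ∞ → ℕ∞ → ℕ∞
fin m +∞ fin n = fin (m ℕ.+ n)
fin _ +∞ ∞     = ∞
∞     +∞ _     = ∞

infix 4 _≤∞_
data _≤∞_ : ℕ∞ → ℕ∞ → Set where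
  fin≤fin : ∀ {m n} → m ≤ n → fin m ≤∞ fin n
  _≤∞∞    : ∀ x → x ≤∞ ∞

-- ord_b(a) = sup { k : b^k ∣ a }  (with 0^0 = 1)
--
-- For b = 2 + c and m > 0: the largest k with (2+c)^k ∣ m, computed by
-- repeated division (fuel m is enough since each step divides m by ≥ 2).
ordℕ : (fuel c m : ℕ) → ℕ
ordℕ zero    c m = 0
ordℕ (suc f) c m with suc (suc c) ∣? m
... | yes _ = suc (ordℕ f c (m / suc (suc c)))
... | no  _ = 0

ord : ℕ → ℤ → ℕ∞
ord zero          a with ∣ a ∣
... | zero  = ∞
... | suc _ = fin 0
ord (suc zero)    a = ∞
ord (suc (suc c)) a with ∣ a ∣
... | zero  = ∞
... | suc m = fin (ordℕ (suc m) c (suc m))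

partialSum : (ℕ → ℤ) → ℕ → ℕ → ℤ → ℕ∞
partialSum a b zero    x = fin 0
partialSum a b (suc i) x = partialSum a b i x +∞ ord b (x - a i)

record BOrdering (S : ℤ → Set) (b : ℕ) : Set where
  field
    seq     : ℕ → ℤ
    inS     : ∀ i → S (seq i)
    minimal : ∀ i → 1 ≤ i → ∀ x → S x →
              partialSum seq b i (seq i) ≤∞ partialSum seq b i x

α : ∀ {S b} → BOrdering S b → ℕ → ℕ∞
α {b = b} o k = partialSum (BOrdering.seq o) b k (BOrdering.seq o k)

pow∞ : ℕ → ℕ∞ → ℕ
pow∞ b             (fin k) = b ^ k
pow∞ (suc zero)    ∞       = 1
pow∞ zero          ∞       = 0
pow∞ (suc (suc _)) ∞       = 0

-- k!_{S,T} = ∏_{b ∈ T} b^{α_k(S,b)}, with T ⊆ ℕ given as a Bool-valued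
-- characteristic function and a chosen b-ordering for every b.

factor : ∀ {S} → (T : ℕ → Bool) → ((b : ℕ) → BOrdering S b) → ℕ → ℕ → ℕ
factor T ords k b = if T b then pow∞ b (α (ords b) k) else 1

prodBelow : (ℕ → ℕ) → ℕ → ℕ
prodBelow f zero    = 1
prodBelow f (suc B) = prodBelow f B * f B

-- "k!_{S,T} = m": the (possibly infinite) product over T has only finitely
-- many factors ≠ 1, and m is its value.
IsFactorial : ∀ {S} → (T : ℕ → Bool) → ((b : ℕ) → BOrdering S b) → ℕ → ℕ → Set
IsFactorial T ords k m =
  Σ ℕ λ B → (∀ b → B ≤ b → factor T ords k b ≡ 1)
          × m ≡ prodBelow (factor T ords k) B

AtLeast : (S : ℤ → Set) → ℕ → Set
AtLeast S n = Σ (Fin n → ℤ) λ e → Injective _≡_ _≡_ e × (∀ i → S (e i))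

{-# OPTIONS --safe #-}
-- Fix n + 1 distinct elements e₀, …, eₙ of S and k ≤ n.  Each of the first
-- k terms of a b-ordering is "close" (equal, or congruent mod b) to at most
-- one eᵢ, so by pigeonhole some eᵢ is close to none of them, and minimality
-- bounds α_k(S,b) by the partial sum at eᵢ.  Hence α_k(S,0) = 0, α_k(S,b)
-- is finite for b ≥ 2, and α_k(S,b) = 0 once b exceeds every |eᵢ − eⱼ|; so
-- both factorials are finite products with nonzero factors.  Finally
-- α_{k}(S,b) ≤ α_{k+1}(S,b) always, so each factor b^{α_n} is a multiple
-- b^{α_n − α_{n−1}} of b^{α_{n−1}}.
module Submission where

open import Defs
open import Data.Nat using (ℕ; zero; suc; _+_; _*_; _∸_; _^_; _≤_; _<_; _⊔_; z≤n; s≤s; ≢-nonZero)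
import Data.Nat.Properties as ℕ
open import Algebra.Properties.CommutativeSemigroup ℕ.*-commutativeSemigroup
  using () renaming (interchange to *-interchange)
open import Data.Nat.Divisibility using (_∣_; _∣?_; _∣0; ∣⇒≤)
open import Data.Integer using (ℤ; ∣_∣; +_; _-_; 0ℤ)
import Data.Integer.Properties as ℤ
open import Data.Integer.Tactic.RingSolver renaming (solve-∀ to solve-∀ℤ)
open import Data.Integer.Divisibility.Signed as ℤ∣ using ()
open import Data.Bool using (Bool; true; false; if_then_else_)
open import Data.Bool.Properties using (if-eta)
open import Data.Fin using (Fin; toℕ; fromℕ<)
import Data.Fin.Properties as Finₚ
open import Data.Product using (Σ; ∃; _×_; _,_; proj₁; proj₂)
open import Function using (_∘_)
open import Function.Definitions using (Injective)
open import Relation.Nullary using (¬_; Dec; yes; no; contradiction)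
open import Relation.Binary.PropositionalEquality

[x-z]-[y-z]≡x-y : ∀ x y z → (x - z) - (y - z) ≡ x - y
[x-z]-[y-z]≡x-y = solve-∀ℤ

IsFin : ℕ∞ → Set
IsFin x = ∃ λ c → x ≡ fin c

≤∞-trans : ∀ {x y z} → x ≤∞ y → y ≤∞ z → x ≤∞ z
≤∞-trans (fin≤fin p) (fin≤fin q) = fin≤fin (ℕ.≤-trans p q)
≤∞-trans _           (y ≤∞∞)     = _ ≤∞∞

≤∞-+∞ : ∀ x y → x ≤∞ x +∞ y
≤∞-+∞ (fin m) (fin n) = fin≤fin (ℕ.m≤m+n m n)
≤∞-+∞ (fin m) ∞       = fin m ≤∞∞
≤∞-+∞ ∞       y       = ∞ ≤∞∞

fin-≤∞-inv : ∀ {p q} → fin p ≤∞ fin q → p ≤ q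
fin-≤∞-inv (fin≤fin p≤q) = p≤q

≤∞-fin⇒fin : ∀ {x c} → x ≤∞ fin c → IsFin x
≤∞-fin⇒fin (fin≤fin _) = _ , refl

≤∞-0⇒≡0 : ∀ {x} → x ≤∞ fin 0 → x ≡ fin 0
≤∞-0⇒≡0 (fin≤fin z≤n) = refl

ord₀-≢0 : ∀ {x} → x ≢ 0ℤ → ord 0 x ≡ fin 0
ord₀-≢0 {x} x≢0 with ∣ x ∣ in eq
... | zero  = contradiction (ℤ.∣i∣≡0⇒i≡0 eq) x≢0
... | suc _ = refl

ord-≢0-finite : ∀ c {x} → x ≢ 0ℤ → IsFin (ord (suc (suc c)) x)
ord-≢0-finite c {x} x≢0 with ∣ x ∣ in eq
... | zero  = contradiction (ℤ.∣i∣≡0⇒i≡0 eq) x≢0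
... | suc _ = _ , refl

ord-∤ : ∀ c {x} → ¬ (+ suc (suc c) ℤ∣.∣ x) → ord (suc (suc c)) x ≡ fin 0
ord-∤ c {x} b∤x with ∣ x ∣ in eq
... | zero = contradiction (ℤ∣.∣ᵤ⇒∣ (subst (suc (suc c) ∣_) (sym eq) (_ ∣0))) b∤x
... | suc m with suc (suc c) ∣? suc m
...   | yes b∣x = contradiction (ℤ∣.∣ᵤ⇒∣ (subst (suc (suc c) ∣_) (sym eq) b∣x)) b∤x
...   | no  _   = refl

partialSum-preserves : (P : ℕ∞ → Set) → P (fin 0) → (∀ {x y} → P x → P y → P (x +∞ y)) →
                       ∀ a b k x → (∀ j → j < k → P (ord b (x - a j))) → P (partialSum a b k x)
partialSum-preserves P P0 P+ a b zero    x _  = P0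
partialSum-preserves P P0 P+ a b (suc k) x Pj =
  P+ (partialSum-preserves P P0 P+ a b k x (λ j j<k → Pj j (ℕ.m<n⇒m<1+n j<k))) (Pj k (ℕ.n<1+n k))

partialSum-≡0 : ∀ a b k x → (∀ j → j < k → ord b (x - a j) ≡ fin 0) → partialSum a b k x ≡ fin 0
partialSum-≡0 = partialSum-preserves (_≡ fin 0) refl λ { refl refl → refl }

partialSum-finite : ∀ a b k x → (∀ j → j < k → IsFin (ord b (x - a j))) → IsFin (partialSum a b k x)
partialSum-finite = partialSum-preserves IsFin (0 , refl) λ { (m , refl) (n , refl) → m + n , refl }

module _ {S : ℤ → Set} {b : ℕ} (o : BOrdering S b) where
  open BOrdering o

  α-≤-partialSum : ∀ k → ∀ {x} → S x → α o k ≤∞ partialSum seq b k x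
  α-≤-partialSum zero    _  = fin≤fin z≤n
  α-≤-partialSum (suc k) Sx = minimal (suc k) (s≤s z≤n) _ Sx

  α-mono : ∀ k → α o k ≤∞ α o (suc k)
  α-mono k = ≤∞-trans (α-≤-partialSum k (inS (suc k)))
                      (≤∞-+∞ (partialSum seq b k (seq (suc k))) (ord b (seq (suc k) - seq k)))

∃-unrelated : ∀ {n k} {A : Set} (R : Fin (suc n) → A → Set) → (∀ i y → Dec (R i y)) →
              (∀ {i i′ y} → R i y → R i′ y → i ≡ i′) → (a : ℕ → A) → k ≤ n →
              ∃ λ i → ∀ j → j < k → ¬ R i (a j)
∃-unrelated {n} {k} R R? unique a k≤n
  with Finₚ.all? (λ i → Finₚ.any? {n = k} (λ j → R? i (a (toℕ j))))
... | yes related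
  with Finₚ.pigeonhole (s≤s k≤n) (proj₁ ∘ related)
...   | i , i′ , i<i′ , same =
  contradiction (unique (proj₂ (related i)) (subst (R i′ ∘ a ∘ toℕ) (sym same) (proj₂ (related i′))))
                (Finₚ.<⇒≢ i<i′)
∃-unrelated {n} {k} R R? unique a k≤n | no ¬related
  with Finₚ.¬∀⟶∃¬ (suc n) _ (λ i → Finₚ.any? {n = k} (λ j → R? i (a (toℕ j)))) ¬related
... | i , ¬rel = i , λ j j<k r → ¬rel (fromℕ< j<k , subst (R i ∘ a) (sym (Finₚ.toℕ-fromℕ< j<k)) r)

bounded : ∀ {n} (f : Fin n → ℕ) → ∃ λ M → ∀ i → f i ≤ M
bounded {zero}  f = 0 , λ ()
bounded {suc n} f with bounded (f ∘ Fin.suc)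
... | M , f≤M = f Fin.zero ⊔ M , λ { Fin.zero → ℕ.m≤m⊔n _ M ; (Fin.suc i) → ℕ.m≤n⇒m≤o⊔n _ (f≤M i) }

module Distinct {S : ℤ → Set} {n : ℕ} (e : Fin (suc n) → ℤ)
                (injective : Injective _≡_ _≡_ e) (inS : ∀ i → S (e i)) where

  diff≢0 : ∀ {i y} → e i ≢ y → e i - y ≢ 0ℤ
  diff≢0 {i} {y} ne = ne ∘ ℤ.i-j≡0⇒i≡j (e i) y

  α-≤-unrelated : ∀ {b} (o : BOrdering S b) (R : Fin (suc n) → ℤ → Set) → (∀ i y → Dec (R i y)) →
                  (∀ {i i′ y} → R i y → R i′ y → i ≡ i′) → ∀ k → k ≤ n →
                  ∃ λ i → (∀ j → j < k → ¬ R i (BOrdering.seq o j))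
                        × α o k ≤∞ partialSum (BOrdering.seq o) _ k (e i)
  α-≤-unrelated o R R? unique k k≤n with ∃-unrelated R R? unique (BOrdering.seq o) k≤n
  ... | i , ¬R = i , ¬R , α-≤-partialSum o k (inS i)

  equal-unique : ∀ {i i′ y} → e i ≡ y → e i′ ≡ y → i ≡ i′
  equal-unique p q = injective (trans p (sym q))

  α₀≡0 : (o : BOrdering S 0) → ∀ k → k ≤ n → α o k ≡ fin 0
  α₀≡0 o k k≤n with α-≤-unrelated o (_≡_ ∘ e) (ℤ._≟_ ∘ e) equal-unique k k≤n
  ... | i , ≢seq , α≤ =
    ≤∞-0⇒≡0 (subst (α o k ≤∞_)
                    (partialSum-≡0 _ 0 k (e i) (λ j j<k → ord₀-≢0 (diff≢0 (≢seq j j<k)))) α≤)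

  α-finite : ∀ c (o : BOrdering S (suc (suc c))) → ∀ k → k ≤ n → IsFin (α o k)
  α-finite c o k k≤n with α-≤-unrelated o (_≡_ ∘ e) (ℤ._≟_ ∘ e) equal-unique k k≤n
  ... | i , ≢seq , α≤
    with partialSum-finite _ _ k (e i) (λ j j<k → ord-≢0-finite c (diff≢0 (≢seq j j<k)))
  ... | p , ps≡p = ≤∞-fin⇒fin (subst (α o k ≤∞_) ps≡p α≤)

  diameter : ∃ λ D → ∀ i i′ → ∣ e i - e i′ ∣ ≤ D
  diameter with bounded (∣_∣ ∘ e)
  ... | M , ≤M = M + M , λ i i′ → ℕ.≤-trans (ℤ.∣i-j∣≤∣i∣+∣j∣ (e i) (e i′)) (ℕ.+-mono-≤ (≤M i) (≤M i′))

  D : ℕ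
  D = proj₁ diameter

  -- Distinct elements differ by at most D < b, so they are not congruent mod b.
  congruent-unique : ∀ c → D ≤ c → ∀ {i i′ y} →
                     + suc (suc c) ℤ∣.∣ e i - y → + suc (suc c) ℤ∣.∣ e i′ - y → i ≡ i′
  congruent-unique c D≤c {i} {i′} {y} b∣ b∣′ with i Finₚ.≟ i′
  ... | yes i≡i′ = i≡i′
  ... | no  i≢i′ = contradiction (ℕ.≤-trans (proj₂ diameter i i′) D≤c)
                                 (ℕ.<⇒≱ (ℕ.≤-trans (ℕ.n≤1+n (suc c)) b≤diff))
    where
    b∣diff : + suc (suc c) ℤ∣.∣ e i - e i′
    b∣diff = subst (+ suc (suc c) ℤ∣.∣_) ([x-z]-[y-z]≡x-y (e i) (e i′) y) (ℤ∣.∣m∣n⇒∣m-n b∣ b∣′)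
    b≤diff : suc (suc c) ≤ ∣ e i - e i′ ∣
    b≤diff = ∣⇒≤ ⦃ ≢-nonZero (diff≢0 (i≢i′ ∘ injective) ∘ ℤ.∣i∣≡0⇒i≡0) ⦄ (ℤ∣.∣⇒∣ᵤ b∣diff)

  α-large≡0 : ∀ c → D ≤ c → (o : BOrdering S (suc (suc c))) → ∀ k → k ≤ n → α o k ≡ fin 0
  α-large≡0 c D≤c o k k≤n
    with α-≤-unrelated o (λ i y → + suc (suc c) ℤ∣.∣ e i - y) (λ i y → _ ℤ∣.∣? _)
                       (congruent-unique c D≤c) k k≤n
  ... | i , ∤seq , α≤ =
    ≤∞-0⇒≡0 (subst (α o k ≤∞_) (partialSum-≡0 _ _ k (e i) (λ j j<k → ord-∤ c (∤seq j j<k))) α≤)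

pow∞-1 : ∀ x → pow∞ 1 x ≡ 1
pow∞-1 (fin k) = ℕ.^-zeroˡ k
pow∞-1 ∞       = refl

if-then-1-pos : ∀ t {x} → 1 ≤ x → 1 ≤ (if t then x else 1)
if-then-1-pos true  1≤x = 1≤x
if-then-1-pos false _   = ℕ.≤-refl

prodBelow-* : ∀ {f g h} → (∀ b → f b ≡ g b * h b) → ∀ B → prodBelow f B ≡ prodBelow g B * prodBelow h B
prodBelow-* {f} {g} {h} f≡gh zero    = refl
prodBelow-* {f} {g} {h} f≡gh (suc B) = begin
  prodBelow f B * f B                             ≡⟨ cong₂ _*_ (prodBelow-* f≡gh B) (f≡gh B) ⟩
  (prodBelow g B * prodBelow h B) * (g B * h B)   ≡⟨ *-interchange (prodBelow g B) _ _ _ ⟩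
  (prodBelow g B * g B) * (prodBelow h B * h B)   ∎
  where open ≡-Reasoning

prodBelow-pos : ∀ {f} → (∀ b → 1 ≤ f b) → ∀ B → 1 ≤ prodBelow f B
prodBelow-pos f-pos zero    = ℕ.≤-refl
prodBelow-pos f-pos (suc B) = ℕ.*-mono-≤ (prodBelow-pos f-pos B) (f-pos B)

module _ {S : ℤ → Set} (T : ℕ → Bool) (ords : (b : ℕ) → BOrdering S b) where

  factor-fin : ∀ k {b p} → α (ords b) k ≡ fin p → factor T ords k b ≡ (if T b then b ^ p else 1)
  factor-fin k {b} α≡p = cong (λ x → if T b then pow∞ b x else 1) α≡p

  factor-≡1 : ∀ k {b} → α (ords b) k ≡ fin 0 → factor T ords k b ≡ 1
  factor-≡1 k {b} α≡0 = trans (factor-fin k α≡0) (if-eta (T b))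

  factor-at-1 : ∀ k → factor T ords k 1 ≡ 1
  factor-at-1 k with T 1
  ... | true  = pow∞-1 (α (ords 1) k)
  ... | false = refl

  factor-pos : ∀ k {c p} → α (ords (suc c)) k ≡ fin p → 1 ≤ factor T ords k (suc c)
  factor-pos k {c} {p} α≡p =
    subst (1 ≤_) (sym (factor-fin k α≡p)) (if-then-1-pos (T (suc c)) (ℕ.m^n>0 (suc c) p))

  factor-ratio : ∀ k k′ {b p q} → α (ords b) k ≡ fin p → α (ords b) k′ ≡ fin q → p ≤ q →
                 factor T ords k′ b ≡ (if T b then b ^ (q ∸ p) else 1) * factor T ords k b
  factor-ratio k k′ {b} {p} {q} α≡p α≡q p≤q = begin
    factor T ords k′ b                  ≡⟨ factor-fin k′ α≡q ⟩
    (if T b then b ^ q else 1)          ≡⟨ split (T b) ⟩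
    g * (if T b then b ^ p else 1)      ≡⟨ cong (g *_) (sym (factor-fin k α≡p)) ⟩
    g * factor T ords k b               ∎
    where
    open ≡-Reasoning
    g = if T b then b ^ (q ∸ p) else 1
    split : ∀ t → (if t then b ^ q else 1) ≡ (if t then b ^ (q ∸ p) else 1) * (if t then b ^ p else 1)
    split true  = trans (cong (b ^_) (sym (ℕ.m∸n+n≡m p≤q))) (ℕ.^-distribˡ-+-* b (q ∸ p) p)
    split false = refl

module Quotient {S : ℤ → Set} (T : ℕ → Bool) (ords : (b : ℕ) → BOrdering S b) {n : ℕ}
                (e : Fin (suc (suc n)) → ℤ) (injective : Injective _≡_ _≡_ e)
                (inS : ∀ i → S (e i)) where
  open Distinct {S} e injective inS

  n≤1+n : n ≤ suc n
  n≤1+n = ℕ.n≤1+n n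

  Ratio : ℕ → Set
  Ratio b = Σ ℕ λ g → 1 ≤ g × factor T ords (suc n) b ≡ g * factor T ords n b

  trivial-ratio : ∀ {b} → factor T ords (suc n) b ≡ 1 → factor T ords n b ≡ 1 →
                  Ratio b × 1 ≤ factor T ords n b
  trivial-ratio f≡1 f′≡1 =
    (1 , ℕ.≤-refl , trans f≡1 (cong (1 *_) (sym f′≡1))) , subst (1 ≤_) (sym f′≡1) ℕ.≤-refl

  ratio : ∀ b → Ratio b × 1 ≤ factor T ords n b
  ratio zero    = trivial-ratio (factor-≡1 T ords (suc n) (α₀≡0 (ords 0) (suc n) ℕ.≤-refl))
                                (factor-≡1 T ords n (α₀≡0 (ords 0) n n≤1+n))
  ratio (suc zero) = trivial-ratio (factor-at-1 T ords (suc n)) (factor-at-1 T ords n)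
  ratio b@(suc (suc c)) with α-finite c (ords b) n n≤1+n | α-finite c (ords b) (suc n) ℕ.≤-refl
  ... | p , α≡p | q , α≡q =
    ( (if T b then b ^ (q ∸ p) else 1) , if-then-1-pos (T b) (ℕ.m^n>0 b (q ∸ p))
    , factor-ratio T ords n (suc n) α≡p α≡q (fin-≤∞-inv (subst₂ _≤∞_ α≡p α≡q (α-mono (ords b) n))) )
    , factor-pos T ords n α≡p

  B : ℕ
  B = suc (suc D)

  factor-beyond-B : ∀ k → k ≤ suc n → ∀ b → B ≤ b → factor T ords k b ≡ 1
  factor-beyond-B k k≤1+n (suc (suc c)) (s≤s (s≤s D≤c)) =
    factor-≡1 T ords k (α-large≡0 c D≤c (ords _) k k≤1+n)

theorem3p12 : (S : ℤ → Set) → (T : ℕ → Bool) → ∃ S →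
    (ords : (b : ℕ) → BOrdering S b) →
    (n : ℕ) → 1 ≤ n → AtLeast S (suc n) →
    Σ ℕ λ m → Σ ℕ λ m′ →
    IsFactorial T ords n m × IsFactorial T ords (n ∸ 1) m′ ×
    m′ ≢ 0 × Σ ℕ λ q → 1 ≤ q × m ≡ q * m′
theorem3p12 S T _ ords (suc n) (s≤s z≤n) (e , injective , inS) =
    prodBelow (factor T ords (suc n)) B , prodBelow (factor T ords n) B
  , (B , factor-beyond-B (suc n) ℕ.≤-refl , refl) , (B , factor-beyond-B n n≤1+n , refl)
  , ℕ.n>0⇒n≢0 (prodBelow-pos (proj₂ ∘ ratio) B)
  , prodBelow (proj₁ ∘ proj₁ ∘ ratio) B , prodBelow-pos (proj₁ ∘ proj₂ ∘ proj₁ ∘ ratio) B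
  , prodBelow-* (proj₂ ∘ proj₂ ∘ proj₁ ∘ ratio) B
  where open Quotient T ords e injective inS
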